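{- $t(2,2)=4$.
   Context: A hypergraph is intersecting if every two of its edges intersect. $\tau(H)$ is the minimum size of a vertex set meeting every edge of $H$. Given a vector $\vec{a}=(a_1,\ldots,a_p)$ of positive integers with $\sum a_i=r$, an $r$-uniform hypergraph $H$ is $\vec{a}$-partitioned if $V(H)=\bigcup_{i\le p}V_i$ with the $V_i$ pairwise disjoint and $|e\cap V_i|=a_i$ for all edges $e$ and all $i$. $t(a_1,\ldots,a_p)$ is the maximum of $\tau(H)$ over all finite intersecting $\vec{a}$-partitioned $r$-uniform hypergraphs $H$. -}

module Defs where

open import Data.Nat using (ℕ; _≤_)
open import Data.Fin using (Fin; _≟_)
open import Data.Fin.Subset using (Subset; _∩_; ∣_∣; Nonempty; _∈_)
open import Data.Vec using (tabulate)
open import Data.List using (List)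
open import Data.List.Relation.Unary.All using (All)
import Data.List.Membership.Propositional as LM
open import Data.Product using (Σ; _×_)
open import Relation.Nullary.Decidable using (⌊_⌋)
open import Relation.Binary.PropositionalEquality using (_≡_)

-- A finite hypergraph whose vertex set is Fin n, together with a partition of
-- the vertex set into p pairwise disjoint classes V_0,...,V_{p-1}
-- (vertex v lies in class  part v ).
record PHypergraph (p : ℕ) : Set where
  field
    n     : ℕ
    part  : Fin n → Fin p
    edges : List (Subset n)
open PHypergraph public

V : ∀ {p} (H : PHypergraph p) → Fin p → Subset (n H)
V H i = tabulate (λ v → ⌊ part H v ≟ i ⌋)

Intersecting : ∀ {p} → PHypergraph p → Set
Intersecting H = ∀ {e f} → e LM.∈ edges H → f LM.∈ edges H → Nonempty (e ∩ f)

-- a-partitioned: |e ∩ V_i| = a_i for every edge e and every i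
-- (this implies r-uniformity with r = Σ a_i)
Partitioned : ∀ {p} → (Fin p → ℕ) → PHypergraph p → Set
Partitioned a H = ∀ {e} → e LM.∈ edges H → ∀ i → ∣ e ∩ V H i ∣ ≡ a i

Cover : ∀ {p} (H : PHypergraph p) → Subset (n H) → Set
Cover H C = All (λ e → Nonempty (e ∩ C)) (edges H)

TauAtMost : ∀ {p} → PHypergraph p → ℕ → Set
TauAtMost H k = Σ (Subset (n H)) λ C → Cover H C × ∣ C ∣ ≤ k

TauAtLeast : ∀ {p} → PHypergraph p → ℕ → Set
TauAtLeast H k = ∀ C → Cover H C → k ≤ ∣ C ∣

TValue : ∀ {p} → (Fin p → ℕ) → ℕ → Set
TValue {p} a k =
  (∀ (H : PHypergraph p) → Intersecting H → Partitioned a H → TauAtMost H k)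
  × Σ (PHypergraph p) (λ H → Intersecting H × Partitioned a H
                              × TauAtMost H k × TauAtLeast H k)

a22 : Fin 2 → ℕ
a22 _ = 2

-- In an intersecting hypergraph every edge meets every other
-- edge, so any single edge is a vertex cover.  In an a-partitioned hypergraph
-- an edge e splits along the classes V_i, so |e| = Σ_i |e ∩ V_i| = Σ_i a_i.
-- Hence t(a) ≤ Σ_i a_i for every vector a; for a = (2,2) this gives τ ≤ 4.
--
-- An explicit (2,2)-partitioned intersecting hypergraph on
-- 2 × 5 vertices with 12 edges has τ = 4.  Intersection, the partition
-- condition and "no cover with fewer than 4 vertices" are all decidable for
-- a concrete finite hypergraph (the last one by enumerating all 2^10 vertex
-- subsets), so the example is certified by running these decision procedures.
module Submission where

open import Defs
open import Data.Nat using (ℕ; suc; _+_; _≤_; _<?_; z≤n)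
open import Data.Nat.Properties as ℕ using (+-0-commutativeMonoid; ≮⇒≥; ≤-reflexive)
open import Data.Bool using (Bool; true; false; _∧_)
open import Data.Fin using (Fin; zero; suc; _≟_; #_; inject+; raise; splitAt)
import Data.Fin.Properties as Fin
open import Data.Fin.Subset using (Subset; _∩_; _∪_; ∣_∣; Nonempty; ⊥; ⁅_⁆)
open import Data.Fin.Subset.Properties using (∣⊥∣≡0; nonempty?; anySubset?)
open import Data.Vec using ([]; _∷_; tabulate)
open import Data.List using ([]; _∷_)
open import Data.List.Relation.Unary.All as All using (All; []; all?)
open import Data.List.Relation.Unary.Any using (here)
import Data.List.Membership.Propositional as LM
open import Data.Product using (_,_)
open import Data.Sum using ([_,_]′)
open import Function using (const)
open import Relation.Nullary using (Dec; yes; no)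
open import Relation.Nullary.Decidable using (⌊_⌋; map′; _×-dec_; from-yes)
open import Relation.Binary.PropositionalEquality
  using (_≡_; refl; cong; cong₂; sym; trans; subst; module ≡-Reasoning)
open import Algebra.Properties.CommutativeMonoid.Sum +-0-commutativeMonoid
  using (sum; ∑-distrib-+; sum-cong-≗; sum-replicate-zero)

private
  variable
    m p : ℕ

class : (Fin m → Fin p) → Fin p → Subset m
class part i = tabulate (λ v → ⌊ part v ≟ i ⌋)

indicator : Bool → ℕ
indicator true  = 1
indicator false = 0

∣b∷v∣ : ∀ b (v : Subset m) → ∣ b ∷ v ∣ ≡ indicator b + ∣ v ∣
∣b∷v∣ true  v = refl
∣b∷v∣ false v = refl

⌊suc≟suc⌋ : (j i : Fin p) → ⌊ suc j ≟ suc i ⌋ ≡ ⌊ j ≟ i ⌋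
⌊suc≟suc⌋ j i with j ≟ i
... | yes _ = refl
... | no  _ = refl

∑-indicator-≟ : (j : Fin p) → sum (λ i → indicator ⌊ j ≟ i ⌋) ≡ 1
∑-indicator-≟ {suc p} zero    = cong suc (sum-replicate-zero p)
∑-indicator-≟ {suc p} (suc j) =
  trans (sum-cong-≗ (λ i → cong indicator (⌊suc≟suc⌋ j i))) (∑-indicator-≟ j)

∑-indicator-∧ : ∀ x (j : Fin p) → sum (λ i → indicator (x ∧ ⌊ j ≟ i ⌋)) ≡ indicator x
∑-indicator-∧ true  j = ∑-indicator-≟ j
∑-indicator-∧ {p} false j = sum-replicate-zero p

size-decomposition : (part : Fin m → Fin p) (e : Subset m) →
                     ∣ e ∣ ≡ sum (λ i → ∣ e ∩ class part i ∣)
size-decomposition {p = p} part []      = sym (sum-replicate-zero p)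
size-decomposition {m = suc m} {p} part (x ∷ e) = begin
  ∣ x ∷ e ∣
    ≡⟨ ∣b∷v∣ x e ⟩
  indicator x + ∣ e ∣
    ≡⟨ cong₂ _+_ (sym (∑-indicator-∧ x (part zero)))
                 (size-decomposition (λ v → part (suc v)) e) ⟩
  sum (λ i → indicator (x ∧ δ i)) + sum (λ i → ∣ e ∩ class′ i ∣)
    ≡⟨ sym (∑-distrib-+ (λ i → indicator (x ∧ δ i)) (λ i → ∣ e ∩ class′ i ∣)) ⟩
  sum (λ i → indicator (x ∧ δ i) + ∣ e ∩ class′ i ∣)
    ≡⟨ sum-cong-≗ (λ i → sym (∣b∷v∣ (x ∧ δ i) (e ∩ class′ i))) ⟩
  sum (λ i → ∣ (x ∷ e) ∩ class part i ∣)
    ∎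
  where
  open ≡-Reasoning
  δ : Fin p → Bool
  δ i = ⌊ part zero ≟ i ⌋
  class′ : Fin p → Subset m
  class′ = class (λ v → part (suc v))

edge-size : (a : Fin p → ℕ) (H : PHypergraph p) → Partitioned a H →
            ∀ {e} → e LM.∈ edges H → ∣ e ∣ ≡ sum a
edge-size a H par {e} e∈ =
  trans (size-decomposition (part H) e) (sum-cong-≗ (par e∈))

edge-covers : (H : PHypergraph p) → Intersecting H →
              ∀ {e} → e LM.∈ edges H → Cover H e
edge-covers H inter e∈ = All.tabulate (λ f∈ → inter f∈ e∈)

-- t(a) ≤ Σ_i a_i: an edge is a cover of the right size (the empty set if
-- there are no edges)
tau≤∑a : (a : Fin p → ℕ) (H : PHypergraph p) →
         Intersecting H → Partitioned a H → TauAtMost H (sum a)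
tau≤∑a a H@record { edges = [] }    _     _   = ⊥ , [] , subst (_≤ sum a) (sym (∣⊥∣≡0 (n H))) z≤n
tau≤∑a a H@record { edges = e ∷ _ } inter par =
  e , edge-covers H inter (here refl) , ≤-reflexive (edge-size a H par (here refl))

intersecting? : (H : PHypergraph p) → Dec (Intersecting H)
intersecting? H =
  map′ (λ pairwise e∈ f∈ → All.lookup (All.lookup pairwise e∈) f∈)
       (λ inter → All.tabulate λ e∈ → All.tabulate λ f∈ → inter e∈ f∈)
       (all? (λ e → all? (λ f → nonempty? (e ∩ f)) (edges H)) (edges H))

partitioned? : (a : Fin p → ℕ) (H : PHypergraph p) → Dec (Partitioned a H)
partitioned? a H =
  map′ All.lookup All.tabulate
       (all? (λ e → Fin.all? (λ i → ∣ e ∩ V H i ∣ ℕ.≟ a i)) (edges H))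

cover? : (H : PHypergraph p) (C : Subset (n H)) → Dec (Cover H C)
cover? H C = all? (λ e → nonempty? (e ∩ C)) (edges H)

tauAtLeast? : (H : PHypergraph p) (k : ℕ) → Dec (TauAtLeast H k)
tauAtLeast? H k with anySubset? (λ C → cover? H C ×-dec ∣ C ∣ <? k)
... | yes (C , cov , small) = no (λ atLeast → ℕ.≤⇒≯ (atLeast C cov) small)
... | no noSmallCover       = yes (λ C cov → ≮⇒≥ (λ small → noSmallCover (C , cov , small)))

-- The extremal example has vertex classes V₀ = {0,…,4} and V₁ = {5,…,9}.
halves : Fin (5 + 5) → Fin 2
halves v = [ const zero , const (suc zero) ]′ (splitAt 5 v)

edge : (x x′ y y′ : Fin 5) → Subset (5 + 5)
edge x x′ y y′ = ⁅ inject+ 5 x ⁆ ∪ ⁅ inject+ 5 x′ ⁆ ∪ ⁅ raise 5 y ⁆ ∪ ⁅ raise 5 y′ ⁆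

example : PHypergraph 2
example = record
  { n     = 5 + 5
  ; part  = halves
  ; edges = edge (# 1) (# 4) (# 1) (# 3) ∷ edge (# 2) (# 4) (# 1) (# 3)
          ∷ edge (# 0) (# 3) (# 1) (# 4) ∷ edge (# 1) (# 2) (# 0) (# 4)
          ∷ edge (# 0) (# 1) (# 1) (# 2) ∷ edge (# 0) (# 2) (# 2) (# 3)
          ∷ edge (# 2) (# 3) (# 0) (# 1) ∷ edge (# 3) (# 4) (# 2) (# 4)
          ∷ edge (# 0) (# 4) (# 0) (# 2) ∷ edge (# 1) (# 3) (# 0) (# 3)
          ∷ edge (# 0) (# 3) (# 3) (# 4) ∷ edge (# 2) (# 3) (# 1) (# 2)
          ∷ []
  }

example-intersecting : Intersecting example
example-intersecting = from-yes (intersecting? example)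

example-partitioned : Partitioned a22 example
example-partitioned = from-yes (partitioned? a22 example)

example-τ≥4 : TauAtLeast example 4
example-τ≥4 = from-yes (tauAtLeast? example 4)

mainTheorem6 : TValue a22 4
mainTheorem6 =
  tau≤∑a a22 ,
  ( example , example-intersecting , example-partitioned
  , tau≤∑a a22 example example-intersecting example-partitioned
  , example-τ≥4 )
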